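{- Let $f,g:\mathbb{F}_2^{2m}\to\mathbb{F}_2$ be bent functions. If $f$ is extended affine equivalent to its dual $\tilde f$ and $g$ is extended translation equivalent to $f$, then $\tilde g$ is extended affine equivalent to $g$. Consequently, the set of extended Cayley equivalence classes of the duals of the bent functions in the extended translation class of $f$ equals the set of extended Cayley equivalence classes of the bent functions in that extended translation class. Conversely, for a bent function $f$, if there is some bent function $g$ extended translation equivalent to $f$ such that $\tilde g$ is not extended affine equivalent to $g$, then no bent function in the extended translation class of $f$ (including $f$ itself) is extended affine equivalent to its dual.
   Context: $\langle x,y\rangle=\sum_ix_iy_i$ over $\mathbb{F}_2$. $W_f(x)=\sum_y(-1)^{f(y)+\langle x,y\rangle}$; $f$ is bent iff $|W_f|\equiv2^m$; its dual $\tilde f$ is defined by $(-1)^{\tilde f(x)}=2^{ -m}W_f(x)$ (and is bent). Extended affine equivalence: $h(x)=f(Ax+b)+\langle c,x\rangle+\delta$ with $A\in GL(2m,2)$, $b,c\in\mathbb{F}_2^{2m}$, $\delta\in\mathbb{F}_2$; extended translation equivalence: the same with $A=I$. For $u$ with $u(0)=0$, $\mathrm{Cay}(u)$ is the simple graph on $\mathbb{F}_2^{2m}$ with $i\sim j$ iff $u(i+j)=1$; $f,g$ are extended Cayley equivalent iff $\mathrm{Cay}(f+f(0))\cong\mathrm{Cay}(g+g(0))$. -}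

module Defs where

open import Data.Bool using (Bool; true; false; _xor_; _∧_)
open import Data.Nat using (ℕ; zero; suc; _^_; _*_)
open import Data.Integer as ℤ using (ℤ; ∣_∣; _<?_; 0ℤ; 1ℤ; -1ℤ)
open import Data.Fin using (Fin; _≟_)
open import Data.Vec using (Vec; []; _∷_; zipWith; foldr; map; replicate; transpose; tabulate)
open import Data.List as L using (List; []; _∷_; _++_)
open import Data.Product using (Σ; ∃; _×_; _,_)
open import Relation.Nullary using (does)
open import Relation.Binary.PropositionalEquality using (_≡_)
open import Function.Bundles using (_↔_; Inverse)

-- Vectors of F₂ⁿ are Vec Bool n; addition in F₂ is xor, multiplication is ∧.
V : ℕ → Set
V n = Vec Bool n

BF : ℕ → Set
BF n = V n → Bool

_⊕_ : ∀ {n} → V n → V n → V n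
_⊕_ = zipWith _xor_

0v : ∀ {n} → V n
0v = replicate _ false

⟨_,_⟩ : ∀ {n} → V n → V n → Bool
⟨ x , y ⟩ = foldr _ _xor_ false (zipWith _∧_ x y)

allVecs : (n : ℕ) → List (V n)
allVecs zero = [] ∷ []
allVecs (suc n) = L.map (false ∷_) (allVecs n) ++ L.map (true ∷_) (allVecs n)

sgn : Bool → ℤ
sgn false = 1ℤ
sgn true = -1ℤ

W : ∀ {n} → BF n → V n → ℤ
W {n} f x = L.foldr ℤ._+_ 0ℤ (L.map (λ y → sgn (f y xor ⟨ x , y ⟩)) (allVecs n))

Bent : (m : ℕ) → BF (2 * m) → Set
Bent m f = ∀ x → ∣ W f x ∣ ≡ 2 ^ m

-- dual: (-1)^{f̃(x)} = 2^{-m} W_f(x), i.e. f̃(x) = 1 iff W_f(x) < 0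
dual : ∀ {n} → BF n → BF n
dual f x = does (W f x <? 0ℤ)

-- n×n matrices over F₂ (as lists of rows)
Mat : ℕ → Set
Mat n = Vec (Vec Bool n) n

_·_ : ∀ {n} → Mat n → V n → V n
A · x = map (λ row → ⟨ row , x ⟩) A

_⊗_ : ∀ {n} → Mat n → Mat n → Mat n
A ⊗ B = map (λ row → map (λ col → ⟨ row , col ⟩) (transpose B)) A

idMat : ∀ {n} → Mat n
idMat = tabulate (λ i → tabulate (λ j → does (i ≟ j)))

Invertible : ∀ {n} → Mat n → Set
Invertible {n} A = Σ (Mat n) (λ B → (A ⊗ B ≡ idMat) × (B ⊗ A ≡ idMat))

EAEquiv : ∀ {n} → BF n → BF n → Set
EAEquiv {n} f h =
  Σ (Mat n) λ A → Invertible A × Σ (V n) λ b → Σ (V n) λ c → Σ Bool λ δ →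
    ∀ x → h x ≡ (f ((A · x) ⊕ b) xor ⟨ c , x ⟩) xor δ

ETEquiv : ∀ {n} → BF n → BF n → Set
ETEquiv {n} f h =
  Σ (V n) λ b → Σ (V n) λ c → Σ Bool λ δ →
    ∀ x → h x ≡ (f (x ⊕ b) xor ⟨ c , x ⟩) xor δ

-- Cayley graphs: Cay(u) on F₂ⁿ, i ∼ j iff u(i+j) = 1 (u(0) = 0)
-- Graph isomorphism Cay(u) ≅ Cay(v): a bijection π of vertices preserving adjacency
CayIso : ∀ {n} → BF n → BF n → Set
CayIso {n} u v = Σ (V n ↔ V n) λ π →
  ∀ i j → u (i ⊕ j) ≡ v (Inverse.to π i ⊕ Inverse.to π j)

normalize : ∀ {n} → BF n → BF n
normalize f x = f x xor f 0v

CayEquiv : ∀ {n} → BF n → BF n → Set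
CayEquiv f g = CayIso (normalize f) (normalize g)

-- Adding ⟨c,x⟩ + δ to a translate x ↦ f(x+b) only translates the Walsh spectrum of f by c
-- and multiplies it by the sign (-1)^(⟨c,b⟩+δ+⟨x,b⟩). Hence the dual of an extended translate
-- of a bent f is an extended translate of f̃, and every extended translate of f̃ is such a dual.
-- Extended affine transforms absorb extended translates, so f ~EA f̃ propagates through the
-- extended translation class. Finally, an extended affine transform of f is an extended
-- translate of f composed with x ↦ Ax, which is an isomorphism of Cayley graphs.

module Submission where

open import Defs
open import Data.Nat using (ℕ; _*_)
import Data.Nat as ℕ
open import Data.Product using (Σ; _×_)
open import Relation.Nullary using (¬_)

open import Data.Bool using (Bool; true; false; _xor_; _∧_)
open import Data.Bool.Properties using (xor-assoc; xor-same; xor-identityʳ; ∧-comm; ∧-zeroʳ; xor-∧-commutativeRing)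
open import Data.Nat.Properties using (m^n>0; <⇒≢)
open import Data.Integer as ℤ using (ℤ; ∣_∣; 0ℤ; +_; -[1+_]; +[1+_])
import Data.Integer.Properties as ℤ
open import Data.Fin using (Fin; zero; suc; _≟_)
open import Data.Vec using (Vec; []; _∷_; map; replicate; transpose; tabulate; lookup; _⊛_)
import Data.Vec.Properties as Vec
open import Data.List as List using (List; []; _∷_)
import Data.List.Properties as List
open import Data.Maybe using (just; nothing)
open import Data.Product using (_,_)
open import Function using (id; _∘_)
open import Function.Bundles using (Inverse; mk↔ₛ′)
open import Function.Properties.Inverse using (↔-sym)
open import Relation.Nullary using (does)
open import Data.Empty using (⊥-elim)
open import Relation.Binary.PropositionalEquality
open import Tactic.RingSolver using (solve-∀)
open import Tactic.RingSolver.Core.AlmostCommutativeRing using (AlmostCommutativeRing; fromCommutativeRing)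

open ≡-Reasoning

-- The ring solver works in any commutative ring, so it cannot use x xor x ≡ false;
-- such cancellations are done by hand below.
boolRing : AlmostCommutativeRing _ _
boolRing = fromCommutativeRing xor-∧-commutativeRing λ { false → just refl ; true → nothing }

⊕-assoc : ∀ {n} (x y z : V n) → (x ⊕ y) ⊕ z ≡ x ⊕ (y ⊕ z)
⊕-assoc []      []      []      = refl
⊕-assoc (a ∷ x) (b ∷ y) (c ∷ z) = cong₂ _∷_ (xor-assoc a b c) (⊕-assoc x y z)

⊕-same : ∀ {n} (x : V n) → x ⊕ x ≡ 0v
⊕-same []      = refl
⊕-same (a ∷ x) = cong₂ _∷_ (xor-same a) (⊕-same x)

⊕-identityʳ : ∀ {n} (x : V n) → x ⊕ 0v ≡ x
⊕-identityʳ []      = refl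
⊕-identityʳ (a ∷ x) = cong₂ _∷_ (xor-identityʳ a) (⊕-identityʳ x)

⊕-cancelʳ : ∀ {n} (x y : V n) → (x ⊕ y) ⊕ y ≡ x
⊕-cancelʳ x y = begin
  (x ⊕ y) ⊕ y ≡⟨ ⊕-assoc x y y ⟩
  x ⊕ (y ⊕ y) ≡⟨ cong (x ⊕_) (⊕-same y) ⟩
  x ⊕ 0v      ≡⟨ ⊕-identityʳ x ⟩
  x           ∎

⟨⟩-comm : ∀ {n} (x y : V n) → ⟨ x , y ⟩ ≡ ⟨ y , x ⟩
⟨⟩-comm []      []      = refl
⟨⟩-comm (a ∷ x) (b ∷ y) = cong₂ _xor_ (∧-comm a b) (⟨⟩-comm x y)

⟨⟩-zeroˡ : ∀ {n} (x : V n) → ⟨ 0v , x ⟩ ≡ false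
⟨⟩-zeroˡ []      = refl
⟨⟩-zeroˡ (a ∷ x) = ⟨⟩-zeroˡ x

⟨⟩-zeroʳ : ∀ {n} (x : V n) → ⟨ x , 0v ⟩ ≡ false
⟨⟩-zeroʳ x = trans (⟨⟩-comm x 0v) (⟨⟩-zeroˡ x)

⟨⟩-distribʳ-⊕ : ∀ {n} (z x y : V n) → ⟨ x ⊕ y , z ⟩ ≡ ⟨ x , z ⟩ xor ⟨ y , z ⟩
⟨⟩-distribʳ-⊕ []      []      []      = refl
⟨⟩-distribʳ-⊕ (c ∷ z) (a ∷ x) (b ∷ y) =
  trans (cong (((a xor b) ∧ c) xor_) (⟨⟩-distribʳ-⊕ z x y)) (interchange a b c ⟨ x , z ⟩ ⟨ y , z ⟩)
  where
  interchange : ∀ a b c p q → ((a xor b) ∧ c) xor (p xor q) ≡ ((a ∧ c) xor p) xor ((b ∧ c) xor q)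
  interchange = solve-∀ boolRing

⟨⟩-distribˡ-⊕ : ∀ {n} (z x y : V n) → ⟨ z , x ⊕ y ⟩ ≡ ⟨ z , x ⟩ xor ⟨ z , y ⟩
⟨⟩-distribˡ-⊕ z x y = begin
  ⟨ z , x ⊕ y ⟩             ≡⟨ ⟨⟩-comm z (x ⊕ y) ⟩
  ⟨ x ⊕ y , z ⟩             ≡⟨ ⟨⟩-distribʳ-⊕ z x y ⟩
  ⟨ x , z ⟩ xor ⟨ y , z ⟩   ≡⟨ cong₂ _xor_ (⟨⟩-comm x z) (⟨⟩-comm y z) ⟩
  ⟨ z , x ⟩ xor ⟨ z , y ⟩   ∎

-- Rectangular versions of _·_ and of multiplication by the transpose, so that
-- facts about them can be proved by induction on the rows.
_∙_ : ∀ {n k} → Vec (V n) k → V n → V k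
M ∙ x = map (λ row → ⟨ row , x ⟩) M

_ᵀ∙_ : ∀ {n k} → Vec (V n) k → V k → V n
M ᵀ∙ u = map (λ col → ⟨ col , u ⟩) (transpose M)

∙-distrib-⊕ : ∀ {n k} (M : Vec (V n) k) (x y : V n) → M ∙ (x ⊕ y) ≡ (M ∙ x) ⊕ (M ∙ y)
∙-distrib-⊕ []      x y = refl
∙-distrib-⊕ (r ∷ M) x y = cong₂ _∷_ (⟨⟩-distribˡ-⊕ r x y) (∙-distrib-⊕ M x y)

∙-zeroʳ : ∀ {n k} (M : Vec (V n) k) → M ∙ 0v ≡ 0v
∙-zeroʳ []      = refl
∙-zeroʳ (r ∷ M) = cong₂ _∷_ (⟨⟩-zeroʳ r) (∙-zeroʳ M)

[]ᵀ∙[] : ∀ {n} (x : V n) → ⟨ [] ᵀ∙ [] , x ⟩ ≡ false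
[]ᵀ∙[] []      = refl
[]ᵀ∙[] (a ∷ x) = []ᵀ∙[] x

∷ᵀ∙∷ : ∀ {n k} (r : V n) (M : Vec (V n) k) (u : Bool) (us : V k) (x : V n) →
  ⟨ (r ∷ M) ᵀ∙ (u ∷ us) , x ⟩ ≡ (u ∧ ⟨ r , x ⟩) xor ⟨ M ᵀ∙ us , x ⟩
∷ᵀ∙∷ r M u us x = go r (transpose M) x
  where
  step : ∀ r u t x a R → (((r ∧ u) xor t) ∧ x) xor ((u ∧ a) xor R) ≡ (u ∧ ((r ∧ x) xor a)) xor ((t ∧ x) xor R)
  step = solve-∀ boolRing
  -- transpose (r ∷ M) unfolds to (replicate _ _∷_ ⊛ r) ⊛ transpose M.
  go : ∀ {n} (r : V n) (T : Vec (V _) n) (x : V n) →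
    ⟨ map (λ col → ⟨ col , u ∷ us ⟩) ((replicate n _∷_ ⊛ r) ⊛ T) , x ⟩
      ≡ (u ∧ ⟨ r , x ⟩) xor ⟨ map (λ col → ⟨ col , us ⟩) T , x ⟩
  go []       []      []       = sym (trans (xor-identityʳ (u ∧ false)) (∧-zeroʳ u))
  go (r ∷ rs) (t ∷ T) (x ∷ xs) =
    trans (cong ((((r ∧ u) xor ⟨ t , us ⟩) ∧ x) xor_) (go rs T xs))
          (step r u ⟨ t , us ⟩ x ⟨ rs , xs ⟩ ⟨ map (λ col → ⟨ col , us ⟩) T , xs ⟩)

⟨⟩-transpose : ∀ {n k} (M : Vec (V n) k) (u : V k) (x : V n) → ⟨ u , M ∙ x ⟩ ≡ ⟨ M ᵀ∙ u , x ⟩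
⟨⟩-transpose []      []       x = sym ([]ᵀ∙[] x)
⟨⟩-transpose (r ∷ M) (u ∷ us) x =
  trans (cong ((u ∧ ⟨ r , x ⟩) xor_) (⟨⟩-transpose M us x)) (sym (∷ᵀ∙∷ r M u us x))

⊗-· : ∀ {n} (A B : Mat n) (x : V n) → (A ⊗ B) · x ≡ A · (B · x)
⊗-· A B x = trans (sym (Vec.map-∘ _ _ A)) (Vec.map-cong row A)
  where
  row : ∀ r → ⟨ map (λ col → ⟨ r , col ⟩) (transpose B) , x ⟩ ≡ ⟨ r , B · x ⟩
  row r = trans (cong (λ v → ⟨ v , x ⟩) (Vec.map-cong (⟨⟩-comm r) (transpose B))) (sym (⟨⟩-transpose B r x))

idMat-· : ∀ {n} (x : V n) → idMat · x ≡ x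
idMat-· x = begin
  idMat · x                              ≡⟨ Vec.tabulate-∘ (λ r → ⟨ r , x ⟩) _ ⟨
  tabulate (λ i → ⟨ unit i , x ⟩)        ≡⟨ Vec.tabulate-cong (λ i → ⟨unit,⟩ i x) ⟩
  tabulate (lookup x)                    ≡⟨ Vec.tabulate∘lookup x ⟩
  x                                      ∎
  where
  unit : ∀ {n} → Fin n → V n
  unit i = tabulate (λ j → does (i ≟ j))
  ⟨zero,⟩ : ∀ {n} (x : V n) → ⟨ tabulate (λ _ → false) , x ⟩ ≡ false
  ⟨zero,⟩ []      = refl
  ⟨zero,⟩ (a ∷ x) = ⟨zero,⟩ x
  ⟨unit,⟩ : ∀ {n} (i : Fin n) (x : V n) → ⟨ unit i , x ⟩ ≡ lookup x i
  ⟨unit,⟩ zero    (a ∷ x) = trans (cong (a xor_) (⟨zero,⟩ x)) (xor-identityʳ a)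
  ⟨unit,⟩ (suc i) (a ∷ x) = ⟨unit,⟩ i x

inverse-· : ∀ {n} (A B : Mat n) → A ⊗ B ≡ idMat → ∀ x → A · (B · x) ≡ x
inverse-· A B AB≡I x = begin
  A · (B · x)   ≡⟨ ⊗-· A B x ⟨
  (A ⊗ B) · x   ≡⟨ cong (_· x) AB≡I ⟩
  idMat · x     ≡⟨ idMat-· x ⟩
  x             ∎

sumℤ : List ℤ → ℤ
sumℤ = List.foldr ℤ._+_ 0ℤ

sumℤ-++ : ∀ (xs ys : List ℤ) → sumℤ (xs List.++ ys) ≡ sumℤ xs ℤ.+ sumℤ ys
sumℤ-++ []       ys = sym (ℤ.+-identityˡ _)
sumℤ-++ (x ∷ xs) ys = trans (cong (λ t → x ℤ.+ t) (sumℤ-++ xs ys)) (sym (ℤ.+-assoc x _ _))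

*-distribˡ-sumℤ : ∀ (s : ℤ) (xs : List ℤ) → s ℤ.* sumℤ xs ≡ sumℤ (List.map (λ x → s ℤ.* x) xs)
*-distribˡ-sumℤ s []       = ℤ.*-zeroʳ s
*-distribˡ-sumℤ s (x ∷ xs) = trans (ℤ.*-distribˡ-+ s x _) (cong (λ t → s ℤ.* x ℤ.+ t) (*-distribˡ-sumℤ s xs))

sumVecs : (n : ℕ) → (V n → ℤ) → ℤ
sumVecs n F = sumℤ (List.map F (allVecs n))

sumVecs-cong : ∀ n {F G : V n → ℤ} → (∀ y → F y ≡ G y) → sumVecs n F ≡ sumVecs n G
sumVecs-cong n F≗G = cong sumℤ (List.map-cong F≗G (allVecs n))

sumVecs-*ˡ : ∀ n (s : ℤ) (F : V n → ℤ) → sumVecs n (λ y → s ℤ.* F y) ≡ s ℤ.* sumVecs n F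
sumVecs-*ˡ n s F = trans (cong sumℤ (List.map-∘ {g = λ x → s ℤ.* x} {f = F} (allVecs n))) (sym (*-distribˡ-sumℤ s (List.map F (allVecs n))))

sumVecs-suc : ∀ n (F : V (ℕ.suc n) → ℤ) →
  sumVecs (ℕ.suc n) F ≡ sumVecs n (λ y → F (false ∷ y)) ℤ.+ sumVecs n (λ y → F (true ∷ y))
sumVecs-suc n F = begin
  sumVecs (ℕ.suc n) F
    ≡⟨ cong sumℤ (List.map-++ F (List.map (false ∷_) (allVecs n)) _) ⟩
  sumℤ (List.map F (List.map (false ∷_) (allVecs n)) List.++ List.map F (List.map (true ∷_) (allVecs n)))
    ≡⟨ sumℤ-++ (List.map F (List.map (false ∷_) (allVecs n))) _ ⟩
  sumℤ (List.map F (List.map (false ∷_) (allVecs n))) ℤ.+ sumℤ (List.map F (List.map (true ∷_) (allVecs n)))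
    ≡⟨ cong₂ (λ xs ys → sumℤ xs ℤ.+ sumℤ ys) (List.map-∘ (allVecs n)) (List.map-∘ (allVecs n)) ⟨
  sumVecs n (λ y → F (false ∷ y)) ℤ.+ sumVecs n (λ y → F (true ∷ y)) ∎

sumVecs-translate : ∀ n (F : V n → ℤ) (b : V n) → sumVecs n (λ y → F (y ⊕ b)) ≡ sumVecs n F
sumVecs-translate ℕ.zero    F []          = refl
sumVecs-translate (ℕ.suc n) F (false ∷ b) = begin
  sumVecs (ℕ.suc n) (λ y → F (y ⊕ (false ∷ b)))
    ≡⟨ sumVecs-suc n _ ⟩
  sumVecs n (λ y → F (false ∷ (y ⊕ b))) ℤ.+ sumVecs n (λ y → F (true ∷ (y ⊕ b)))
    ≡⟨ cong₂ ℤ._+_ (sumVecs-translate n _ b) (sumVecs-translate n _ b) ⟩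
  sumVecs n (λ y → F (false ∷ y)) ℤ.+ sumVecs n (λ y → F (true ∷ y))
    ≡⟨ sumVecs-suc n F ⟨
  sumVecs (ℕ.suc n) F ∎
sumVecs-translate (ℕ.suc n) F (true ∷ b) = begin
  sumVecs (ℕ.suc n) (λ y → F (y ⊕ (true ∷ b)))
    ≡⟨ sumVecs-suc n _ ⟩
  sumVecs n (λ y → F (true ∷ (y ⊕ b))) ℤ.+ sumVecs n (λ y → F (false ∷ (y ⊕ b)))
    ≡⟨ cong₂ ℤ._+_ (sumVecs-translate n _ b) (sumVecs-translate n _ b) ⟩
  sumVecs n (λ y → F (true ∷ y)) ℤ.+ sumVecs n (λ y → F (false ∷ y))
    ≡⟨ ℤ.+-comm (sumVecs n (λ y → F (true ∷ y))) _ ⟩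
  sumVecs n (λ y → F (false ∷ y)) ℤ.+ sumVecs n (λ y → F (true ∷ y))
    ≡⟨ sumVecs-suc n F ⟨
  sumVecs (ℕ.suc n) F ∎

-- ETEquiv f g unfolds to g ≗ etTransform b c δ f, and EAEquiv f g to g ≗ affineTransform (A ·_) b c δ f.
affineTransform : ∀ {n} → (V n → V n) → V n → V n → Bool → BF n → BF n
affineTransform L b c δ f x = (f (L x ⊕ b) xor ⟨ c , x ⟩) xor δ

etTransform : ∀ {n} → V n → V n → Bool → BF n → BF n
etTransform = affineTransform id

sgn-xor : ∀ a b → sgn (a xor b) ≡ sgn a ℤ.* sgn b
sgn-xor false false = refl
sgn-xor false true  = refl
sgn-xor true  false = refl
sgn-xor true  true  = refl

W-etTransform : ∀ {n} {f g : BF n} b c δ → (∀ x → g x ≡ etTransform b c δ f x) →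
  ∀ x → W g x ≡ sgn ((⟨ c , b ⟩ xor δ) xor ⟨ x , b ⟩) ℤ.* W f (x ⊕ c)
W-etTransform {n} {f} {g} b c δ g≗Tf x = begin
  W g x
    ≡⟨ sumVecs-cong n (λ y → cong (λ t → sgn (t xor ⟨ x , y ⟩)) (g≗Tf y)) ⟩
  sumVecs n (λ y → sgn (etTransform b c δ f y xor ⟨ x , y ⟩))
    ≡⟨ sumVecs-translate n _ b ⟨
  sumVecs n (λ z → sgn (etTransform b c δ f (z ⊕ b) xor ⟨ x , z ⊕ b ⟩))
    ≡⟨ sumVecs-cong n (λ z → trans (cong sgn (exponent z)) (sgn-xor k _)) ⟩
  sumVecs n (λ z → sgn k ℤ.* sgn (f z xor ⟨ x ⊕ c , z ⟩))
    ≡⟨ sumVecs-*ˡ n (sgn k) _ ⟩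
  sgn k ℤ.* W f (x ⊕ c) ∎
  where
  k : Bool
  k = (⟨ c , b ⟩ xor δ) xor ⟨ x , b ⟩
  rearrange : ∀ F p q d r s → ((F xor (p xor q)) xor d) xor (r xor s) ≡ ((q xor d) xor s) xor (F xor (r xor p))
  rearrange = solve-∀ boolRing
  exponent : ∀ z → etTransform b c δ f (z ⊕ b) xor ⟨ x , z ⊕ b ⟩ ≡ k xor (f z xor ⟨ x ⊕ c , z ⟩)
  exponent z rewrite ⊕-cancelʳ z b | ⟨⟩-distribˡ-⊕ c z b | ⟨⟩-distribˡ-⊕ x z b | ⟨⟩-distribʳ-⊕ z x c =
    rearrange (f z) ⟨ c , z ⟩ ⟨ c , b ⟩ δ ⟨ x , z ⟩ ⟨ x , b ⟩

Bent⇒W≢0 : ∀ {m} {f : BF (2 * m)} → Bent m f → ∀ x → W f x ≢ 0ℤ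
Bent⇒W≢0 {m} bent x W≡0 = <⇒≢ (m^n>0 2 m) (trans (sym (cong ∣_∣ W≡0)) (bent x))

negative-sgn* : ∀ k w → w ≢ 0ℤ → does (sgn k ℤ.* w ℤ.<? 0ℤ) ≡ k xor does (w ℤ.<? 0ℤ)
negative-sgn* false w _ rewrite ℤ.*-identityˡ w = refl
negative-sgn* true  w w≢0 rewrite ℤ.-1*i≡-i w = negate w w≢0
  where
  negate : ∀ w → w ≢ 0ℤ → does (ℤ.- w ℤ.<? 0ℤ) ≡ true xor does (w ℤ.<? 0ℤ)
  negate (+ 0)     0≢0 = ⊥-elim (0≢0 refl)
  negate +[1+ _ ]  _   = refl
  negate -[1+ _ ]  _   = refl

∣sgn*∣ : ∀ k w → ∣ sgn k ℤ.* w ∣ ≡ ∣ w ∣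
∣sgn*∣ false w = cong ∣_∣ (ℤ.*-identityˡ w)
∣sgn*∣ true  w = trans (cong ∣_∣ (ℤ.-1*i≡-i w)) (ℤ.∣-i∣≡∣i∣ w)

ET-bent : ∀ {m} {f g : BF (2 * m)} → Bent m f → ETEquiv f g → Bent m g
ET-bent {m} {f} {g} bent (b , c , δ , g≗Tf) x = begin
  ∣ W g x ∣                                                  ≡⟨ cong ∣_∣ (W-etTransform {f = f} b c δ g≗Tf x) ⟩
  ∣ sgn ((⟨ c , b ⟩ xor δ) xor ⟨ x , b ⟩) ℤ.* W f (x ⊕ c) ∣  ≡⟨ ∣sgn*∣ ((⟨ c , b ⟩ xor δ) xor ⟨ x , b ⟩) (W f (x ⊕ c)) ⟩
  ∣ W f (x ⊕ c) ∣                                            ≡⟨ bent (x ⊕ c) ⟩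
  2 ℕ.^ m                                                    ∎

dual-etTransform : ∀ {m} {f g : BF (2 * m)} b c δ → Bent m f → (∀ x → g x ≡ etTransform b c δ f x) →
  ∀ x → dual g x ≡ etTransform c b (⟨ c , b ⟩ xor δ) (dual f) x
dual-etTransform {m} {f} {g} b c δ bent g≗Tf x = begin
  dual g x
    ≡⟨ cong (λ w → does (w ℤ.<? 0ℤ)) (W-etTransform {f = f} b c δ g≗Tf x) ⟩
  does (sgn ((⟨ c , b ⟩ xor δ) xor ⟨ x , b ⟩) ℤ.* W f (x ⊕ c) ℤ.<? 0ℤ)
    ≡⟨ negative-sgn* ((⟨ c , b ⟩ xor δ) xor ⟨ x , b ⟩) (W f (x ⊕ c)) (Bent⇒W≢0 {m} {f} bent (x ⊕ c)) ⟩
  ((⟨ c , b ⟩ xor δ) xor ⟨ x , b ⟩) xor dual f (x ⊕ c)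
    ≡⟨ cong (λ t → ((⟨ c , b ⟩ xor δ) xor t) xor dual f (x ⊕ c)) (⟨⟩-comm x b) ⟩
  ((⟨ c , b ⟩ xor δ) xor ⟨ b , x ⟩) xor dual f (x ⊕ c)
    ≡⟨ rearrange (⟨ c , b ⟩ xor δ) ⟨ b , x ⟩ (dual f (x ⊕ c)) ⟩
  etTransform c b (⟨ c , b ⟩ xor δ) (dual f) x ∎
  where
  rearrange : ∀ d s D → (d xor s) xor D ≡ (D xor s) xor d
  rearrange = solve-∀ boolRing

ET-dual : ∀ {m} {f g : BF (2 * m)} → Bent m f → ETEquiv f g → ETEquiv (dual f) (dual g)
ET-dual {m} {f} bent (b , c , δ , g≗Tf) = c , b , ⟨ c , b ⟩ xor δ , dual-etTransform {m} {f} b c δ bent g≗Tf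

ET-dual-surjective : ∀ {m} {f k : BF (2 * m)} → Bent m f → ETEquiv (dual f) k →
  Σ (BF (2 * m)) λ g → ETEquiv f g × (∀ x → dual g x ≡ k x)
ET-dual-surjective {m} {f} {k} bent (b , c , δ , k≗Tf̃) = g , (c , b , ε , λ _ → refl) , dual-g≗k
  where
  ε : Bool
  ε = ⟨ b , c ⟩ xor δ
  g : BF (2 * m)
  g = etTransform c b ε f
  cancel : ⟨ b , c ⟩ xor ε ≡ δ
  cancel = trans (sym (xor-assoc ⟨ b , c ⟩ ⟨ b , c ⟩ δ)) (cong (_xor δ) (xor-same ⟨ b , c ⟩))
  dual-g≗k : ∀ x → dual g x ≡ k x
  dual-g≗k x = begin
    dual g x                                       ≡⟨ dual-etTransform {m} {f} c b ε bent (λ _ → refl) x ⟩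
    etTransform b c (⟨ b , c ⟩ xor ε) (dual f) x   ≡⟨ cong ((dual f (x ⊕ b) xor ⟨ c , x ⟩) xor_) cancel ⟩
    etTransform b c δ (dual f) x                   ≡⟨ k≗Tf̃ x ⟨
    k x                                            ∎

affineTransform-cong : ∀ {n} (L : V n → V n) b c δ {f g : BF n} →
  (∀ x → f x ≡ g x) → ∀ x → affineTransform L b c δ f x ≡ affineTransform L b c δ g x
affineTransform-cong L b c δ f≗g x = cong (λ t → (t xor _) xor _) (f≗g _)

affineTransform-∘ : ∀ {n} (L L′ L′ᵀ : V n → V n) →
  (∀ x y → L (x ⊕ y) ≡ L x ⊕ L y) → (∀ u x → ⟨ u , L′ x ⟩ ≡ ⟨ L′ᵀ u , x ⟩) →
  ∀ f b c δ b′ c′ δ′ x →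
  affineTransform L′ b′ c′ δ′ (affineTransform L b c δ f) x
    ≡ affineTransform (L ∘ L′) (L b′ ⊕ b) (L′ᵀ c ⊕ c′) ((⟨ c , b′ ⟩ xor δ) xor δ′) f x
affineTransform-∘ L L′ L′ᵀ L-additive L′-adjoint f b c δ b′ c′ δ′ x = begin
  ((((f (L (L′ x ⊕ b′) ⊕ b) xor ⟨ c , L′ x ⊕ b′ ⟩) xor δ) xor ⟨ c′ , x ⟩) xor δ′)
    ≡⟨ cong₂ (λ y t → (((f y xor t) xor δ) xor ⟨ c′ , x ⟩) xor δ′) point character ⟩
  ((((f y xor (⟨ L′ᵀ c , x ⟩ xor ⟨ c , b′ ⟩)) xor δ) xor ⟨ c′ , x ⟩) xor δ′)
    ≡⟨ rearrange (f y) ⟨ L′ᵀ c , x ⟩ ⟨ c , b′ ⟩ δ ⟨ c′ , x ⟩ δ′ ⟩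
  (f y xor (⟨ L′ᵀ c , x ⟩ xor ⟨ c′ , x ⟩)) xor ((⟨ c , b′ ⟩ xor δ) xor δ′)
    ≡⟨ cong (λ t → (f y xor t) xor ((⟨ c , b′ ⟩ xor δ) xor δ′)) (⟨⟩-distribʳ-⊕ x (L′ᵀ c) c′) ⟨
  (f y xor ⟨ L′ᵀ c ⊕ c′ , x ⟩) xor ((⟨ c , b′ ⟩ xor δ) xor δ′) ∎
  where
  y : V _
  y = L (L′ x) ⊕ (L b′ ⊕ b)
  point : L (L′ x ⊕ b′) ⊕ b ≡ y
  point = trans (cong (_⊕ b) (L-additive (L′ x) b′)) (⊕-assoc (L (L′ x)) (L b′) b)
  character : ⟨ c , L′ x ⊕ b′ ⟩ ≡ ⟨ L′ᵀ c , x ⟩ xor ⟨ c , b′ ⟩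
  character = trans (⟨⟩-distribˡ-⊕ c (L′ x) b′) (cong (_xor ⟨ c , b′ ⟩) (L′-adjoint c x))
  rearrange : ∀ F p q d s e → (((F xor (p xor q)) xor d) xor s) xor e ≡ (F xor (p xor s)) xor ((q xor d) xor e)
  rearrange = solve-∀ boolRing

affineTransform-identity : ∀ {n} (L : V n → V n) → (∀ x → L x ≡ x) →
  ∀ f b c δ x → affineTransform L (L b ⊕ b) (c ⊕ c) (δ xor δ) f x ≡ f x
affineTransform-identity L L≗id f b c δ x
  rewrite L≗id x | L≗id b | ⊕-same b | ⊕-identityʳ x | ⊕-same c | ⟨⟩-zeroˡ x | xor-same δ
  = trans (xor-identityʳ _) (xor-identityʳ (f x))

ET-sym : ∀ {n} {f g : BF n} → ETEquiv f g → ETEquiv g f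
ET-sym {f = f} {g} (b , c , δ , g≗Tf) = b , c , δ′ , λ x → begin
  f x                                                        ≡⟨ affineTransform-identity id (λ _ → refl) f b c δ′ x ⟨
  etTransform (b ⊕ b) (c ⊕ c) (δ′ xor δ′) f x                ≡⟨ affineTransform-∘ id id id (λ _ _ → refl) (λ _ _ → refl) f b c δ b c δ′ x ⟨
  etTransform b c δ′ (etTransform b c δ f) x                 ≡⟨ affineTransform-cong id b c δ′ g≗Tf x ⟨
  etTransform b c δ′ g x                                     ∎
  where
  δ′ : Bool
  δ′ = ⟨ c , b ⟩ xor δ

ET-trans : ∀ {n} {f g h : BF n} → ETEquiv f g → ETEquiv g h → ETEquiv f h
ET-trans {f = f} (b , c , δ , g≗Tf) (b′ , c′ , δ′ , h≗Tg) =
  b′ ⊕ b , c ⊕ c′ , (⟨ c , b′ ⟩ xor δ) xor δ′ , λ x →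
    trans (h≗Tg x) (trans (affineTransform-cong id b′ c′ δ′ g≗Tf x)
      (affineTransform-∘ id id id (λ _ _ → refl) (λ _ _ → refl) f b c δ b′ c′ δ′ x))

EA-ET-trans : ∀ {n} {f g h : BF n} → EAEquiv f g → ETEquiv g h → EAEquiv f h
EA-ET-trans {f = f} (A , A-inv , b , c , δ , g≗Tf) (b′ , c′ , δ′ , h≗Tg) =
  A , A-inv , (A · b′) ⊕ b , c ⊕ c′ , (⟨ c , b′ ⟩ xor δ) xor δ′ , λ x →
    trans (h≗Tg x) (trans (affineTransform-cong id b′ c′ δ′ g≗Tf x)
      (affineTransform-∘ (A ·_) id id (∙-distrib-⊕ A) (λ _ _ → refl) f b c δ b′ c′ δ′ x))

EA-sym : ∀ {n} {f g : BF n} → EAEquiv f g → EAEquiv g f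
EA-sym {f = f} {g} (A , (B , AB≡I , BA≡I) , b , c , δ , g≗Tf) =
  B , (A , BA≡I , AB≡I) , B · b , B ᵀ∙ c , δ′ , λ x → begin
    f x
      ≡⟨ affineTransform-identity (λ y → A · (B · y)) (inverse-· A B AB≡I) f b (B ᵀ∙ c) δ′ x ⟨
    affineTransform (λ y → A · (B · y)) ((A · (B · b)) ⊕ b) ((B ᵀ∙ c) ⊕ (B ᵀ∙ c)) (δ′ xor δ′) f x
      ≡⟨ affineTransform-∘ (A ·_) (B ·_) (B ᵀ∙_) (∙-distrib-⊕ A) (⟨⟩-transpose B) f b c δ (B · b) (B ᵀ∙ c) δ′ x ⟨
    affineTransform (B ·_) (B · b) (B ᵀ∙ c) δ′ (affineTransform (A ·_) b c δ f) x
      ≡⟨ affineTransform-cong (B ·_) (B · b) (B ᵀ∙ c) δ′ g≗Tf x ⟨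
    affineTransform (B ·_) (B · b) (B ᵀ∙ c) δ′ g x ∎
  where
  δ′ : Bool
  δ′ = ⟨ c , B · b ⟩ xor δ

EA-factor : ∀ {n} {f v : BF n} → EAEquiv f v →
  Σ (Mat n) λ A → Invertible A × Σ (BF n) λ h → ETEquiv f h × (∀ x → v x ≡ h (A · x))
EA-factor {f = f} (A , A-inv@(B , _ , BA≡I) , b , c , δ , v≗Tf) =
  A , A-inv , etTransform b (B ᵀ∙ c) δ f , (b , B ᵀ∙ c , δ , λ _ → refl) ,
  λ x → trans (v≗Tf x) (cong (λ t → (f ((A · x) ⊕ b) xor t) xor δ) (character x))
  where
  character : ∀ x → ⟨ c , x ⟩ ≡ ⟨ B ᵀ∙ c , A · x ⟩
  character x = trans (cong ⟨ c ,_⟩ (sym (inverse-· B A BA≡I x))) (⟨⟩-transpose B c (A · x))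

CayIso-sym : ∀ {n} {u v : BF n} → CayIso u v → CayIso v u
CayIso-sym {u = u} {v} (π , u≅v) = ↔-sym π , λ i j → begin
  v (i ⊕ j)                      ≡⟨ cong₂ (λ a b → v (a ⊕ b)) (strictlyInverseˡ i) (strictlyInverseˡ j) ⟨
  v (to (from i) ⊕ to (from j))  ≡⟨ u≅v (from i) (from j) ⟨
  u (from i ⊕ from j)            ∎
  where open Inverse π

CayEquiv-linear : ∀ {n} {u v : BF n} (A : Mat n) → Invertible A → (∀ x → u x ≡ v (A · x)) → CayEquiv u v
CayEquiv-linear {u = u} {v} A (B , AB≡I , BA≡I) u≗vA =
  mk↔ₛ′ (A ·_) (B ·_) (inverse-· A B AB≡I) (inverse-· B A BA≡I) , λ i j → begin
    u (i ⊕ j) xor u 0v                ≡⟨ cong₂ _xor_ (u≗vA (i ⊕ j)) (u≗vA 0v) ⟩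
    v (A · (i ⊕ j)) xor v (A · 0v)    ≡⟨ cong₂ (λ y z → v y xor v z) (∙-distrib-⊕ A i j) (∙-zeroʳ A) ⟩
    v ((A · i) ⊕ (A · j)) xor v 0v    ∎

EA-dual-ET-invariant : ∀ {m} {f g : BF (2 * m)} → Bent m f → EAEquiv f (dual f) → ETEquiv f g → EAEquiv (dual g) g
EA-dual-ET-invariant {m} {f} {g} bent f~f̃ f~g =
  EA-ET-trans {f = dual g} {f} {g} (EA-sym {f = f} {dual g} (EA-ET-trans {f = f} {dual f} {dual g} f~f̃ (ET-dual {m} {f} {g} bent f~g))) f~g

mainTheorem7 :
    (∀ (m : ℕ) (f g : BF (2 * m)) → Bent m f → Bent m g →
       EAEquiv f (dual f) → ETEquiv f g → EAEquiv (dual g) g)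
    ×
    (∀ (m : ℕ) (f : BF (2 * m)) → Bent m f → EAEquiv f (dual f) →
       ((∀ (g : BF (2 * m)) → Bent m g → ETEquiv f g →
           Σ (BF (2 * m)) λ h → Bent m h × ETEquiv f h × CayEquiv (dual g) h)
        ×
        (∀ (h : BF (2 * m)) → Bent m h → ETEquiv f h →
           Σ (BF (2 * m)) λ g → Bent m g × ETEquiv f g × CayEquiv (dual g) h)))
    ×
    (∀ (m : ℕ) (f : BF (2 * m)) → Bent m f →
       (Σ (BF (2 * m)) λ g → Bent m g × ETEquiv f g × ¬ EAEquiv (dual g) g) →
       ∀ (h : BF (2 * m)) → Bent m h → ETEquiv f h → ¬ EAEquiv h (dual h))
mainTheorem7 =
    (λ m f g bent _ f~f̃ f~g → EA-dual-ET-invariant {m} {f} {g} bent f~f̃ f~g)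
  , (λ m f bent f~f̃ → duals⊆class {m} {f} bent f~f̃ , class⊆duals {m} {f} bent f~f̃)
  , λ m f _ (g , _ , f~g , g̃≁g) h bent-h f~h h~h̃ →
      g̃≁g (EA-dual-ET-invariant {m} {h} {g} bent-h h~h̃ (ET-trans {f = h} {f} {g} (ET-sym {f = f} {h} f~h) f~g))
  where
  duals⊆class : ∀ {m} {f : BF (2 * m)} → Bent m f → EAEquiv f (dual f) → ∀ g → Bent m g → ETEquiv f g →
    Σ (BF (2 * m)) λ h → Bent m h × ETEquiv f h × CayEquiv (dual g) h
  duals⊆class {m} {f} bent f~f̃ g _ f~g =
    let A , A-inv , h , f~h , g̃≗hA =
          EA-factor {f = f} {dual g} (EA-ET-trans {f = f} {dual f} {dual g} f~f̃ (ET-dual {m} {f} {g} bent f~g))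
    in  h , ET-bent {m} {f} {h} bent f~h , f~h , CayEquiv-linear {u = dual g} {h} A A-inv g̃≗hA
  class⊆duals : ∀ {m} {f : BF (2 * m)} → Bent m f → EAEquiv f (dual f) → ∀ h → Bent m h → ETEquiv f h →
    Σ (BF (2 * m)) λ g → Bent m g × ETEquiv f g × CayEquiv (dual g) h
  class⊆duals {m} {f} bent f~f̃ h _ f~h =
    let A , A-inv , k , f̃~k , h≗kA =
          EA-factor {f = dual f} {h} (EA-ET-trans {f = dual f} {f} {h} (EA-sym {f = f} {dual f} f~f̃) f~h)
        g , f~g , g̃≗k = ET-dual-surjective {m} {f} {k} bent f̃~k
    in  g , ET-bent {m} {f} {g} bent f~g , f~g ,
        CayIso-sym {u = normalize h} {normalize (dual g)}
          (CayEquiv-linear {u = h} {dual g} A A-inv (λ x → trans (h≗kA x) (sym (g̃≗k (A · x)))))
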